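{- Every sentential logic $\langle\mathcal{L},\mathcal{C},\vdash\rangle$ has a truth-adequate semantics.
   Context: A sentential logic is a triple $\langle\mathcal{L},\mathcal{C},\vdash\rangle$ where $\mathcal{L}$ is the set of formulae freely generated from a set of atoms by a (possibly empty) set $\mathcal{C}$ of connectives ($n$-ary connectives are maps $\mathcal{L}^n\to\mathcal{L}$), and $\vdash\subseteq\mathcal{P}(\mathcal{L})\times\mathcal{P}(\mathcal{L})$ is an arbitrary relation. A semantics is a triple $\langle\mathcal{V},\mathcal{W},[\![\cdot]\!]\rangle$: truth values $\mathcal{V}$, worlds $\mathcal{W}$, and $[\![\cdot]\!]$ assigning to formulae propositions $\mathcal{W}\to\mathcal{V}$, to $n$-ary connectives functions on $n$-tuples of propositions, and to $\vdash$ a relation $\models$ between sets of propositions. It is compositional if $[\![c(F_1,\dots,F_n)]\!]=[\![c]\!]([\![F_1]\!],\dots,[\![F_n]\!])$ for all connectives and formulae; sound and complete if $\Gamma\vdash\Delta$ iff $\{[\![F]\!]:F\in\Gamma\}\models\{[\![F]\!]:F\in\Delta\}$; truth-functional if for each $n$-ary $c$ there is $f_c:\mathcal{V}^n\to\mathcal{V}$ with $[\![c]\!](P_1,\dots,P_n)(w)=f_c(P_1(w),\dots,P_n(w))$ for all propositions $P_i$ and worlds $w$; truth-relational if there is $\Vdash\subseteq\mathcal{P}(\mathcal{V})\times\mathcal{P}(\mathcal{V})$ such that for all sets of propositions $S,P$: $S\models P$ iff $S(w)\Vdash P(w)$ for all $w\in\mathcal{W}$, where $S(w)=\{Q(w):Q\in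 S\}$. A semantics is truth-adequate if it is compositional, sound and complete, truth-functional and truth-relational. -}

module Defs where

open import Data.Nat using (ℕ)
open import Data.Fin using (Fin)
open import Data.Product using (Σ; _×_)
open import Relation.Binary.PropositionalEquality using (_≡_)

Subset : Set → Set₁
Subset A = A → Set

_≐_ : {A : Set} → Subset A → Subset A → Set
_≐_ {A} X Y = (a : A) → (X a → Y a) × (Y a → X a)

-- A binary relation on subsets respects set equality (automatic in set theory).
RespectsSetEq : {A : Set} → (Subset A → Subset A → Set) → Set₁
RespectsSetEq {A} R =
  (X X' Y Y' : Subset A) → X ≐ X' → Y ≐ Y' → R X Y → R X' Y'

data Formula (At : Set) (C : Set) (ar : C → ℕ) : Set where
  atom : At → Formula At C ar
  app  : (c : C) → (Fin (ar c) → Formula At C ar) → Formula At C ar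

record SententialLogic : Set₁ where
  field
    At   : Set
    Conn : Set
    ar   : Conn → ℕ
    _⊢_  : Subset (Formula At Conn ar) → Subset (Formula At Conn ar) → Set
    ⊢-respects : RespectsSetEq _⊢_

record Semantics (𝓛 : SententialLogic) : Set₁ where
  open SententialLogic 𝓛
  field
    V : Set
    W : Set
    ⟦_⟧  : Formula At Conn ar → (W → V)
    ⟦_⟧c : (c : Conn) → (Fin (ar c) → (W → V)) → (W → V)
    _⊨_  : Subset (W → V) → Subset (W → V) → Set

module _ {𝓛 : SententialLogic} (S : Semantics 𝓛) where
  open SententialLogic 𝓛
  open Semantics S

  Prop : Set
  Prop = W → V

  -- {⟦F⟧ : F ∈ Γ}; propositions are compared extensionally (as set-theoretic functions)
  image : Subset (Formula At Conn ar) → Subset Prop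
  image Γ Q = Σ (Formula At Conn ar) λ F → Γ F × ((w : W) → ⟦ F ⟧ w ≡ Q w)

  at : Subset Prop → W → Subset V
  at X w v = Σ Prop λ Q → X Q × (Q w ≡ v)

  Compositional : Set
  Compositional = (c : Conn) (Fs : Fin (ar c) → Formula At Conn ar) (w : W) →
    ⟦ app c Fs ⟧ w ≡ ⟦ c ⟧c (λ i → ⟦ Fs i ⟧) w

  SoundComplete : Set₁
  SoundComplete = (Γ Δ : Subset (Formula At Conn ar)) →
    (Γ ⊢ Δ → image Γ ⊨ image Δ) × (image Γ ⊨ image Δ → Γ ⊢ Δ)

  TruthFunctional : Set
  TruthFunctional = (c : Conn) → Σ ((Fin (ar c) → V) → V) λ f →
    (Ps : Fin (ar c) → Prop) (w : W) → ⟦ c ⟧c Ps w ≡ f (λ i → Ps i w)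

  TruthRelational : Set₁
  TruthRelational = Σ (Subset V → Subset V → Set) λ _⊩_ →
    RespectsSetEq _⊩_ ×
    ((X Y : Subset Prop) →
      (X ⊨ Y → (w : W) → at X w ⊩ at Y w) × (((w : W) → at X w ⊩ at Y w) → X ⊨ Y))

  TruthAdequate : Set₁
  TruthAdequate = Compositional × SoundComplete × TruthFunctional × TruthRelational

module Submission where

-- Take the formulae themselves as truth values and a single world: each formula
-- denotes the constant proposition returning itself, connectives act
-- syntactically, and ⊨ (like the truth relation ⊩) is ⊢ applied to the values
-- at the world. Since those values recover the original set of formulae, ⊢ and ⊨
-- agree up to set equality, which ⊢ respects.

open import Defs
open import Data.Product using (Σ; _×_; _,_; swap)
open import Data.Unit using (⊤; tt)
open import Relation.Binary.PropositionalEquality using (_≡_; refl; subst; trans)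

≐-sym : {A : Set} {X Y : Subset A} → X ≐ Y → Y ≐ X
≐-sym X≐Y a = swap (X≐Y a)

-- The function `at` of Defs, freed from a semantics so that ⊨ can be defined
-- through it; `at S X w` unfolds to `valuesAt X w`.
valuesAt : {W V : Set} → Subset (W → V) → W → Subset V
valuesAt X w v = Σ _ λ Q → X Q × (Q w ≡ v)

module TermModel (𝓛 : SententialLogic) where
  open SententialLogic 𝓛

  Form : Set
  Form = Formula At Conn ar

  termSemantics : Semantics 𝓛
  termSemantics = record
    { V    = Form
    ; W    = ⊤
    ; ⟦_⟧  = λ F _ → F
    ; ⟦_⟧c = λ c Ps w → app c (λ i → Ps i w)
    ; _⊨_  = λ X Y → valuesAt X tt ⊢ valuesAt Y tt
    }

  valuesAt-image : (Γ : Subset Form) → valuesAt (image termSemantics Γ) tt ≐ Γ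
  valuesAt-image Γ F =
      (λ { (Q , (G , ΓG , ⟦G⟧≗Q) , Qtt≡F) → subst Γ (trans (⟦G⟧≗Q tt) Qtt≡F) ΓG })
    , (λ ΓF → (λ _ → F) , (F , ΓF , λ _ → refl) , refl)

  compositional : Compositional termSemantics
  compositional c Fs w = refl

  soundComplete : SoundComplete termSemantics
  soundComplete Γ Δ =
      ⊢-respects Γ _ Δ _ (≐-sym (valuesAt-image Γ)) (≐-sym (valuesAt-image Δ))
    , ⊢-respects _ Γ _ Δ (valuesAt-image Γ) (valuesAt-image Δ)

  truthFunctional : TruthFunctional termSemantics
  truthFunctional c = app c , λ Ps w → refl

  truthRelational : TruthRelational termSemantics
  truthRelational =
    _⊢_ , ⊢-respects , λ X Y → (λ X⊨Y _ → X⊨Y) , (λ ⊩-everywhere → ⊩-everywhere tt)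

  truthAdequate : TruthAdequate termSemantics
  truthAdequate = compositional , soundComplete , truthFunctional , truthRelational

fact2p16 : (𝓛 : SententialLogic) → Σ (Semantics 𝓛) TruthAdequate
fact2p16 𝓛 = termSemantics , truthAdequate
  where open TermModel 𝓛
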